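{- Let $P\subseteq\mathbb{TP}^d$ be a tropical polytope and $\mathcal H$ a tropical hyperplane with $P\cap\mathcal H\ne\emptyset$. Then $P\cap\mathcal H$ is a tropical polytope.
   Context: $\mathbb{TP}^d=\mathbb R^{d+1}/\mathbb R(1,\dots,1)$ with $\oplus=\min$, $\odot=+$ (scalar $\odot$ adds to every coordinate, $\oplus$ componentwise). A tropical polytope is the set of all tropical linear combinations $\lambda_1\odot x_1\oplus\dots\oplus\lambda_n\odot x_n$ ($\lambda_i\in\mathbb R$) of a fixed finite set of points $x_1,\dots,x_n$. For $a=(\alpha_0,\dots,\alpha_d)\in\mathbb R^{d+1}$, the tropical hyperplane defined by $a$ is the set of $(\xi_0,\dots,\xi_d)\in\mathbb{TP}^d$ for which $\min_i(\alpha_i+\xi_i)$ is attained at least twice. -}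

module Defs where

open import Level using (0ℓ)
open import Data.Nat using (ℕ; suc)
open import Data.Fin using (Fin; zero) renaming (suc to fsuc)
open import Data.Product using (Σ; ∃; _×_; _,_)
open import Relation.Nullary using (¬_; Dec; yes; no)
open import Relation.Binary.PropositionalEquality using (_≡_)
open import Relation.Binary.Structures using (IsTotalOrder)
open import Algebra.Structures using (IsCommutativeRing)

-- An abstract model of the real numbers: a Dedekind-complete ordered field
-- (unique up to isomorphism, so this pins down ℝ).  Equality is _≡_ and the
-- order is decidable (classical ℝ).
record RealField : Set₁ where
  infixl 6 _+_
  infixl 7 _*_
  infix 4 _≤_
  field
    Carrier : Set
    _+_ _*_ : Carrier → Carrier → Carrier
    -_      : Carrier → Carrier
    0# 1#   : Carrier
    _≤_     : Carrier → Carrier → Set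
    isCommutativeRing : IsCommutativeRing _≡_ _+_ _*_ -_ 0# 1#
    0≢1     : ¬ (0# ≡ 1#)
    inverse : ∀ x → ¬ (x ≡ 0#) → ∃ λ y → x * y ≡ 1#
    isTotalOrder : IsTotalOrder _≡_ _≤_
    _≤?_    : ∀ x y → Dec (x ≤ y)
    +-mono-≤ : ∀ {x y} z → x ≤ y → x + z ≤ y + z
    *-nonneg : ∀ {x y} → 0# ≤ x → 0# ≤ y → 0# ≤ x * y
    lub : (S : Carrier → Set) → ∃ S → (∃ λ b → ∀ x → S x → x ≤ b) →
          ∃ λ s → (∀ x → S x → x ≤ s) × (∀ b → (∀ x → S x → x ≤ b) → s ≤ b)

module Tropical (ℝ : RealField) where
  open RealField ℝ

  _⊓_ : Carrier → Carrier → Carrier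
  x ⊓ y with x ≤? y
  ... | yes _ = x
  ... | no  _ = y

  minF : ∀ {n} → (Fin (suc n) → Carrier) → Carrier
  minF {ℕ.zero} f = f zero
  minF {suc n}  f = f zero ⊓ minF (λ i → f (fsuc i))

  -- representatives of points of TP^d are vectors in ℝ^{d+1}
  Vec : ℕ → Set
  Vec d = Fin (suc d) → Carrier

  -- equality in TP^d = ℝ^{d+1} / ℝ(1,…,1)
  _∼_ : ∀ {d} → Vec d → Vec d → Set
  x ∼ y = ∃ λ c → ∀ j → x j ≡ y j + c

  _⊙_ : ∀ {d} → Carrier → Vec d → Vec d
  (λ' ⊙ x) j = λ' + x j

  tropComb : ∀ {d n} → (Fin (suc n) → Carrier) → (Fin (suc n) → Vec d) → Vec d
  tropComb λs xs j = minF (λ i → (λs i ⊙ xs i) j)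

  -- the tropical polytope generated by the (nonempty, finite) family xs,
  -- as a subset of TP^d (predicate on representatives, invariant under ∼)
  InPolytope : ∀ {d n} → (Fin (suc n) → Vec d) → Vec d → Set
  InPolytope xs y = ∃ λ λs → y ∼ tropComb λs xs

  InHyperplane : ∀ {d} → Vec d → Vec d → Set
  InHyperplane a ξ =
    Σ _ λ i → Σ _ λ j → ¬ (i ≡ j) ×
      (a i + ξ i ≡ minF (λ k → a k + ξ k)) × (a j + ξ j ≡ minF (λ k → a k + ξ k))

  IsTropicalPolytope : ∀ {d} → (Vec d → Set) → Set
  IsTropicalPolytope {d} S =
    ∃ λ n → ∃ λ (xs : Fin (suc n) → Vec d) →
      ∀ y → (S y → InPolytope xs y) × (InPolytope xs y → S y)

-- Normalise the generators to x̂ₛ = (− a·xₛ) ⊙ xₛ, where a·ξ = minₖ (αₖ + ξₖ), so that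
-- a·x̂ₛ = 0.  If w = ⨁ λₛ ⊙ xₛ lies on the hyperplane, a·w is attained at coordinates i ≠ j;
-- generators p and q realising wᵢ and wⱼ have minimal level λₛ + a·xₛ and attain a·xₚ at i,
-- a·x_q at j.  Hence w = ⨁ₖ (λₖ + a·xₖ) ⊙ (x̂ₚ ⊕ x̂_q ⊕ x̂ₖ), and each x̂ₚ ⊕ x̂_q ⊕ x̂ₖ lies on
-- the hyperplane because its a-product 0 is attained at i and at j.  So the finitely many
-- points of this shape that lie on the hyperplane generate P ∩ H; conversely, P and H are
-- both closed under tropical combinations.
module Submission where

open import Defs
open import Data.Nat using (ℕ; suc)
import Data.Nat as ℕ
open import Data.Fin using (Fin; zero; combine; remQuot) renaming (suc to fsuc)
open import Data.Fin.Properties using (any?; remQuot-combine) renaming (_≟_ to _≟ᶠ_)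
open import Data.Product using (∃; _×_; _,_; proj₁; proj₂; map₂)
open import Data.Sum using (_⊎_; inj₁; inj₂)
open import Data.Vec.Functional using ([]; _∷_)
open import Function using (_∘_)
open import Relation.Nullary using (¬_; Dec; yes; no; contradiction)
open import Relation.Nullary.Decidable using (_×-dec_; ¬?)
open import Relation.Binary.PropositionalEquality using (_≡_; refl; sym; trans; cong; subst; subst₂; module ≡-Reasoning)
open import Relation.Binary.Bundles using (Poset)
open import Relation.Binary.Structures using (IsTotalOrder)
import Relation.Binary.Reasoning.PartialOrder as PosetReasoning
open import Algebra.Bundles using (CommutativeRing)
import Algebra.Properties.AbelianGroup as AbelianGroupProperties
import Algebra.Properties.CommutativeSemigroup as CommutativeSemigroupProperties

Triple : ℕ → Set
Triple m = Fin m × Fin m × Fin m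

members : ∀ {m} → Triple m → Fin 3 → Fin m
members (p , q , k) = p ∷ q ∷ k ∷ []

fromTriple : ∀ {m} → Triple m → Fin (m ℕ.* (m ℕ.* m))
fromTriple (p , q , k) = combine p (combine q k)

toTriple : ∀ {m} → Fin (m ℕ.* (m ℕ.* m)) → Triple m
toTriple {m} t = map₂ (remQuot m) (remQuot (m ℕ.* m) t)

toTriple-fromTriple : ∀ {m} (τ : Triple m) → toTriple (fromTriple τ) ≡ τ
toTriple-fromTriple {m} (p , q , k) =
  trans (cong (map₂ (remQuot m)) (remQuot-combine p (combine q k))) (cong (p ,_) (remQuot-combine q k))

module TropicalConvexity (ℝ : RealField) where
  open RealField ℝ
  open Tropical ℝ
  open IsTotalOrder isTotalOrder
    using (antisym; total; isPartialOrder) renaming (refl to ≤-refl; trans to ≤-trans; reflexive to ≤-reflexive)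

  ring : CommutativeRing _ _
  ring = record { isCommutativeRing = isCommutativeRing }

  open CommutativeRing ring
    using (+-assoc; +-comm; +-identityˡ; +-identityʳ; -‿inverseˡ; +-abelianGroup; +-commutativeSemigroup)
  open AbelianGroupProperties +-abelianGroup using (\\-leftDividesˡ; \\-leftDividesʳ; //-rightDividesˡ; //-rightDividesʳ)
  open CommutativeSemigroupProperties +-commutativeSemigroup using (x∙yz≈y∙xz; x∙yz≈z∙xy; x∙yz≈xz∙y)

  ≤-poset : Poset _ _ _
  ≤-poset = record { isPartialOrder = isPartialOrder }

  module ≤-Reasoning = PosetReasoning ≤-poset

  ≰⇒≥ : ∀ {x y} → ¬ x ≤ y → y ≤ x
  ≰⇒≥ {x} {y} x≰y with total x y
  ... | inj₁ x≤y = contradiction x≤y x≰y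
  ... | inj₂ y≤x = y≤x

  +-monoʳ-≤ : ∀ z {x y} → x ≤ y → z + x ≤ z + y
  +-monoʳ-≤ z {x} {y} x≤y = subst₂ _≤_ (+-comm x z) (+-comm y z) (+-mono-≤ z x≤y)

  +-cancelˡ-≤ : ∀ z {x y} → z + x ≤ z + y → x ≤ y
  +-cancelˡ-≤ z {x} {y} le = subst₂ _≤_ (\\-leftDividesʳ z x) (\\-leftDividesʳ z y) (+-monoʳ-≤ (- z) le)

  _≟_ : (x y : Carrier) → Dec (x ≡ y)
  x ≟ y with x ≤? y | y ≤? x
  ... | yes x≤y | yes y≤x = yes (antisym x≤y y≤x)
  ... | no x≰y  | _       = no (λ x≡y → x≰y (≤-reflexive x≡y))
  ... | yes _   | no y≰x  = no (λ x≡y → y≰x (≤-reflexive (sym x≡y)))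

  upper-bound : ∀ {m} (f : Fin m → Carrier) → ∃ λ B → ∀ i → f i ≤ B
  upper-bound {ℕ.zero} f = 0# , λ ()
  upper-bound {suc m} f with upper-bound (f ∘ fsuc)
  ... | B , tail≤B with f zero ≤? B
  ...   | yes f₀≤B = B , λ { zero → f₀≤B ; (fsuc i) → tail≤B i }
  ...   | no f₀≰B = f zero , λ { zero → ≤-refl ; (fsuc i) → ≤-trans (tail≤B i) (≰⇒≥ f₀≰B) }

  upper-bound₂ : ∀ {m k} (f : Fin m → Fin k → Carrier) → ∃ λ B → ∀ i j → f i j ≤ B
  upper-bound₂ f with upper-bound (λ i → proj₁ (upper-bound (f i)))
  ... | B , rows≤B = B , λ i j → ≤-trans (proj₂ (upper-bound (f i)) j) (rows≤B i)

  ⊓-≤ˡ : ∀ x y → x ⊓ y ≤ x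
  ⊓-≤ˡ x y with x ≤? y
  ... | yes _   = ≤-refl
  ... | no x≰y = ≰⇒≥ x≰y

  ⊓-≤ʳ : ∀ x y → x ⊓ y ≤ y
  ⊓-≤ʳ x y with x ≤? y
  ... | yes x≤y = x≤y
  ... | no _    = ≤-refl

  ≤-⊓ : ∀ {b} x y → b ≤ x → b ≤ y → b ≤ x ⊓ y
  ≤-⊓ x y b≤x b≤y with x ≤? y
  ... | yes _ = b≤x
  ... | no _  = b≤y

  ⊓-sel : ∀ x y → x ⊓ y ≡ x ⊎ x ⊓ y ≡ y
  ⊓-sel x y with x ≤? y
  ... | yes _ = inj₁ refl
  ... | no _  = inj₂ refl

  minF-≤ : ∀ {m} (f : Fin (suc m) → Carrier) i → minF f ≤ f i
  minF-≤ {ℕ.zero} f zero     = ≤-refl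
  minF-≤ {suc m}  f zero     = ⊓-≤ˡ _ _
  minF-≤ {suc m}  f (fsuc i) = ≤-trans (⊓-≤ʳ _ _) (minF-≤ (f ∘ fsuc) i)

  ≤-minF : ∀ {m b} (f : Fin (suc m) → Carrier) → (∀ i → b ≤ f i) → b ≤ minF f
  ≤-minF {ℕ.zero} f b≤f = b≤f zero
  ≤-minF {suc m}  f b≤f = ≤-⊓ _ _ (b≤f zero) (≤-minF (f ∘ fsuc) (b≤f ∘ fsuc))

  minF-attained : ∀ {m} (f : Fin (suc m) → Carrier) → ∃ λ i → minF f ≡ f i
  minF-attained {ℕ.zero} f = zero , refl
  minF-attained {suc m} f with ⊓-sel (f zero) (minF (f ∘ fsuc))
  ... | inj₁ min≡f₀ = zero , min≡f₀
  ... | inj₂ min≡tail with minF-attained (f ∘ fsuc)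
  ...   | i , tail≡ = fsuc i , trans min≡tail tail≡

  minF-cong : ∀ {m} {f g : Fin (suc m) → Carrier} → (∀ i → f i ≡ g i) → minF f ≡ minF g
  minF-cong {f = f} {g} f≗g =
    antisym (≤-minF g λ i → ≤-trans (minF-≤ f i) (≤-reflexive (f≗g i)))
            (≤-minF f λ i → ≤-trans (minF-≤ g i) (≤-reflexive (sym (f≗g i))))

  +-minF : ∀ {m} c (f : Fin (suc m) → Carrier) → c + minF f ≡ minF (λ i → c + f i)
  +-minF c f with minF-attained f
  ... | i , min≡fᵢ = antisym (≤-minF _ λ j → +-monoʳ-≤ c (minF-≤ f j))
                             (≤-trans (minF-≤ _ i) (+-monoʳ-≤ c (≤-reflexive (sym min≡fᵢ))))

  minF-+ : ∀ {m} (f : Fin (suc m) → Carrier) c → minF f + c ≡ minF (λ i → f i + c)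
  minF-+ f c = trans (+-comm _ c) (trans (+-minF c f) (minF-cong λ i → +-comm c (f i)))

  minF-comm : ∀ {m k} (f : Fin (suc m) → Fin (suc k) → Carrier) →
              minF (λ t → minF (f t)) ≡ minF (λ s → minF (λ t → f t s))
  minF-comm f =
    antisym (≤-minF _ λ s → ≤-minF _ λ t → ≤-trans (minF-≤ _ t) (minF-≤ (f t) s))
            (≤-minF _ λ t → ≤-minF _ λ s → ≤-trans (minF-≤ _ s) (minF-≤ (λ t → f t s) t))

  infix 7 _·_
  _·_ : ∀ {d} → Vec d → Vec d → Carrier
  a · ξ = minF (λ k → a k + ξ k)

  tropComb-assoc : ∀ {d n m} (μ : Fin (suc m) → Carrier) (ν : Fin (suc m) → Vec n)
                   (xs : Fin (suc n) → Vec d) l →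
                   tropComb μ (λ t → tropComb (ν t) xs) l ≡ tropComb (λ s → minF (λ t → μ t + ν t s)) xs l
  tropComb-assoc μ ν xs l = begin
    minF (λ t → μ t + minF (λ s → ν t s + xs s l))
      ≡⟨ minF-cong (λ t → +-minF (μ t) (λ s → ν t s + xs s l)) ⟩
    minF (λ t → minF (λ s → μ t + (ν t s + xs s l)))
      ≡⟨ minF-cong (λ t → minF-cong {f = λ s → μ t + (ν t s + xs s l)} λ s → sym (+-assoc (μ t) _ _)) ⟩
    minF (λ t → minF (λ s → μ t + ν t s + xs s l))
      ≡⟨ minF-comm (λ t s → μ t + ν t s + xs s l) ⟩
    minF (λ s → minF (λ t → μ t + ν t s + xs s l))
      ≡⟨ minF-cong (λ s → sym (minF-+ (λ t → μ t + ν t s) (xs s l))) ⟩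
    minF (λ s → minF (λ t → μ t + ν t s) + xs s l)
      ∎
    where open ≡-Reasoning

  ≗⇒∼ : ∀ {d} {y z : Vec d} → (∀ j → y j ≡ z j) → y ∼ z
  ≗⇒∼ y≗z = 0# , λ j → trans (y≗z j) (sym (+-identityʳ _))

  ∼-sym : ∀ {d} {y z : Vec d} → y ∼ z → z ∼ y
  ∼-sym {z = z} (c , y≡z+c) = - c , λ j → trans (sym (//-rightDividesʳ c (z j))) (cong (_+ - c) (sym (y≡z+c j)))

  InPolytope-∼ : ∀ {d n} {xs : Fin (suc n) → Vec d} {y z} → y ∼ z → InPolytope xs z → InPolytope xs y
  InPolytope-∼ (c , y≡z+c) (λs , c′ , z≡w+c′) =
    λs , c′ + c , λ j → trans (y≡z+c j) (trans (cong (_+ c) (z≡w+c′ j)) (+-assoc _ c′ c))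

  InPolytope-generator : ∀ {d n} (xs : Fin (suc n) → Vec d) s → InPolytope xs (xs s)
  InPolytope-generator xs s =
    κ , ≗⇒∼ λ l → antisym (≤-minF _ (xsₛ≤ l)) (≤-trans (minF-≤ _ s) (≤-reflexive (κₛ l)))
    where
    spread : ∃ λ B → ∀ t l → xs s l + - xs t l ≤ B
    spread = upper-bound₂ λ t l → xs s l + - xs t l

    -- weight B keeps every other generator from undercutting xs s
    B : Carrier
    B = proj₁ spread

    κ : ∀ t → Carrier
    κ t with t ≟ᶠ s
    ... | yes _ = 0#
    ... | no _  = B

    xsₛ≤ : ∀ l t → xs s l ≤ κ t + xs t l
    xsₛ≤ l t with t ≟ᶠ s
    ... | yes refl = ≤-reflexive (sym (+-identityˡ _))
    ... | no _     = subst (_≤ B + xs t l) (//-rightDividesˡ (xs t l) (xs s l))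
                           (+-mono-≤ (xs t l) (proj₂ spread t l))

    κₛ : ∀ l → κ s + xs s l ≡ xs s l
    κₛ l with s ≟ᶠ s
    ... | yes _   = +-identityˡ _
    ... | no s≢s = contradiction refl s≢s

  InPolytope-tropComb : ∀ {d n m} (xs : Fin (suc n) → Vec d) (μ : Fin (suc m) → Carrier)
                        (G : Fin (suc m) → Vec d) → (∀ t → InPolytope xs (G t)) → InPolytope xs (tropComb μ G)
  InPolytope-tropComb {n = n} {m} xs μ G G∈P =
    (λ s → minF (λ t → μ′ t + ν t s)) ,
    ≗⇒∼ λ l → trans (minF-cong λ t → shift t l) (tropComb-assoc μ′ ν xs l)
    where
    ν : Fin (suc m) → Vec n
    ν t = proj₁ (G∈P t)

    c : Fin (suc m) → Carrier
    c t = proj₁ (proj₂ (G∈P t))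

    μ′ : Fin (suc m) → Carrier
    μ′ t = μ t + c t

    shift : ∀ t l → μ t + G t l ≡ μ′ t + tropComb (ν t) xs l
    shift t l = trans (cong (μ t +_) (proj₂ (proj₂ (G∈P t)) l)) (x∙yz≈xz∙y (μ t) _ (c t))

  InHyperplane-intro : ∀ {d} {a ξ : Vec d} b {i j} → ¬ i ≡ j → (∀ l → b ≤ a l + ξ l) →
                       a i + ξ i ≤ b → a j + ξ j ≤ b → InHyperplane a ξ
  InHyperplane-intro {a = a} {ξ} b {i} {j} i≢j b≤ i≤b j≤b = i , j , i≢j , attains i≤b , attains j≤b
    where
    attains : ∀ {k} → a k + ξ k ≤ b → a k + ξ k ≡ a · ξ
    attains {k} k≤b = antisym (≤-trans k≤b (≤-minF _ b≤)) (minF-≤ _ k)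

  InHyperplane-∼ : ∀ {d} {a y z : Vec d} → y ∼ z → InHyperplane a z → InHyperplane a y
  InHyperplane-∼ {a = a} {y} {z} (c , y≡z+c) (i , j , i≢j , i-attains , j-attains) =
    InHyperplane-intro (c + a · z) i≢j
      (λ l → ≤-trans (+-monoʳ-≤ c (minF-≤ _ l)) (≤-reflexive (sym (translate l))))
      (≤-reflexive (trans (translate i) (cong (c +_) i-attains)))
      (≤-reflexive (trans (translate j) (cong (c +_) j-attains)))
    where
    translate : ∀ l → a l + y l ≡ c + (a l + z l)
    translate l = trans (cong (a l +_) (y≡z+c l)) (x∙yz≈z∙xy (a l) (z l) c)

  InHyperplane-tropComb : ∀ {d m} {a : Vec d} (μ : Fin (suc m) → Carrier) (G : Fin (suc m) → Vec d) b →
                          (∀ t → b ≤ μ t + a · G t) → ∀ {t t′ i j} → ¬ i ≡ j →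
                          μ t + (a i + G t i) ≤ b → μ t′ + (a j + G t′ j) ≤ b →
                          InHyperplane a (tropComb μ G)
  InHyperplane-tropComb {a = a} μ G b b≤ {t} {t′} i≢j tᵢ≤b t′ⱼ≤b =
    InHyperplane-intro b i≢j lower (upper t tᵢ≤b) (upper t′ t′ⱼ≤b)
    where
    lower : ∀ l → b ≤ a l + tropComb μ G l
    lower l with minF-attained (λ s → μ s + G s l)
    ... | s , min≡ = begin
      b                        ≤⟨ b≤ s ⟩
      μ s + a · G s            ≤⟨ +-monoʳ-≤ (μ s) (minF-≤ _ l) ⟩
      μ s + (a l + G s l)      ≡⟨ x∙yz≈y∙xz (μ s) (a l) (G s l) ⟩
      a l + (μ s + G s l)      ≡⟨ cong (a l +_) (sym min≡) ⟩
      a l + tropComb μ G l     ∎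
      where open ≤-Reasoning

    upper : ∀ {i} s → μ s + (a i + G s i) ≤ b → a i + tropComb μ G i ≤ b
    upper {i} s sᵢ≤b = ≤-trans (+-monoʳ-≤ (a i) (minF-≤ _ s)) (subst (_≤ b) (x∙yz≈y∙xz (μ s) (a i) (G s i)) sᵢ≤b)

  InHyperplane-tropComb-closed : ∀ {d m} {a : Vec d} (μ : Fin (suc m) → Carrier) (G : Fin (suc m) → Vec d) →
                                 (∀ t → InHyperplane a (G t)) → InHyperplane a (tropComb μ G)
  InHyperplane-tropComb-closed {a = a} μ G G∈H with minF-attained (λ t → μ t + a · G t)
  ... | t , min≡ with G∈H t
  ...   | i , j , i≢j , i-attains , j-attains =
    InHyperplane-tropComb μ G (μ t + a · G t) (λ s → subst (_≤ _) min≡ (minF-≤ _ s)) {t} {t} i≢j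
      (≤-reflexive (cong (μ t +_) i-attains)) (≤-reflexive (cong (μ t +_) j-attains))

  InHyperplane? : ∀ {d} (a ξ : Vec d) → Dec (InHyperplane a ξ)
  InHyperplane? a ξ = any? λ i → any? λ j → ¬? (i ≟ᶠ j) ×-dec (_ ≟ _) ×-dec (_ ≟ _)

  module Intersection {d n} (xs : Fin (suc n) → Vec d) (a : Vec d) where

    normaliser : Fin (suc n) → Carrier
    normaliser s = - (a · xs s)

    candidate : Triple (suc n) → Vec d
    candidate τ = tropComb (normaliser ∘ members τ) (xs ∘ members τ)

    Active : Fin (suc n) → Fin (suc d) → Set
    Active s i = a i + xs s i ≡ a · xs s

    candidate-≤ : ∀ τ u l → candidate τ l ≤ normaliser (members τ u) + xs (members τ u) l
    candidate-≤ τ u l = minF-≤ (λ u → normaliser (members τ u) + xs (members τ u) l) u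

    candidate-∈P : ∀ τ → InPolytope xs (candidate τ)
    candidate-∈P τ =
      InPolytope-tropComb xs (normaliser ∘ members τ) (xs ∘ members τ) λ u → InPolytope-generator xs (members τ u)

    candidate-∈H : ∀ {p q i j} k → ¬ i ≡ j → Active p i → Active q j → InHyperplane a (candidate (p , q , k))
    candidate-∈H {p} {q} k i≢j p-active q-active =
      InHyperplane-tropComb (normaliser ∘ members (p , q , k)) (xs ∘ members (p , q , k)) 0#
        (λ u → ≤-reflexive (sym (-‿inverseˡ _))) {zero} {fsuc zero} i≢j
        (≤-reflexive (trans (cong (normaliser p +_) p-active) (-‿inverseˡ _)))
        (≤-reflexive (trans (cong (normaliser q +_) q-active) (-‿inverseˡ _)))

    module Decomposition (λs : Fin (suc n) → Carrier) where

      w : Vec d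
      w = tropComb λs xs

      level : Fin (suc n) → Carrier
      level s = λs s + a · xs s

      Minimal : Fin (suc n) → Set
      Minimal p = ∀ s → level p ≤ level s

      level-split : ∀ s l → λs s + xs s l ≡ level s + (normaliser s + xs s l)
      level-split s l = begin
        λs s + xs s l                               ≡⟨ cong (λs s +_) (sym (\\-leftDividesˡ (a · xs s) (xs s l))) ⟩
        λs s + (a · xs s + (normaliser s + xs s l)) ≡⟨ sym (+-assoc (λs s) _ _) ⟩
        level s + (normaliser s + xs s l)           ∎
        where open ≡-Reasoning

      ·-≤-level : ∀ s → a · w ≤ level s
      ·-≤-level s with minF-attained (λ l → a l + xs s l)
      ... | l , min≡ = begin
        a · w                  ≤⟨ minF-≤ _ l ⟩
        a l + w l              ≤⟨ +-monoʳ-≤ (a l) (minF-≤ _ s) ⟩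
        a l + (λs s + xs s l)  ≡⟨ x∙yz≈y∙xz (a l) (λs s) (xs s l) ⟩
        λs s + (a l + xs s l)  ≡⟨ cong (λs s +_) (sym min≡) ⟩
        level s                ∎
        where open ≤-Reasoning

      active-minimal : ∀ {i} → a i + w i ≡ a · w → ∃ λ p → Active p i × Minimal p
      active-minimal {i} i-attains with minF-attained (λ s → λs s + xs s i)
      ... | p , wᵢ≡ = p , p-active , λ s → ≤-trans levelₚ≤ (·-≤-level s)
        where
        a·w≡ : a · w ≡ λs p + (a i + xs p i)
        a·w≡ = trans (sym i-attains) (trans (cong (a i +_) wᵢ≡) (x∙yz≈y∙xz (a i) (λs p) (xs p i)))

        p-active : Active p i
        p-active = antisym (+-cancelˡ-≤ (λs p) (subst (_≤ level p) a·w≡ (·-≤-level p))) (minF-≤ _ i)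

        levelₚ≤ : level p ≤ a · w
        levelₚ≤ = subst (level p ≤_) (sym a·w≡) (+-monoʳ-≤ (λs p) (minF-≤ _ i))

      w-via-candidates : ∀ {p q} → Minimal p → Minimal q →
                         ∀ l → w l ≡ tropComb level (λ k → candidate (p , q , k)) l
      w-via-candidates {p} {q} p-minimal q-minimal l with minF-attained (λ s → λs s + xs s l)
      ... | k , wₗ≡ = antisym (≤-minF _ below) (begin
        tropComb level (λ k → candidate (p , q , k)) l  ≤⟨ minF-≤ _ k ⟩
        level k + candidate (p , q , k) l                ≤⟨ +-monoʳ-≤ (level k) (candidate-≤ (p , q , k) (fsuc (fsuc zero)) l) ⟩
        level k + (normaliser k + xs k l)                ≡⟨ sym (level-split k l) ⟩
        λs k + xs k l                                    ≡⟨ sym wₗ≡ ⟩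
        w l                                              ∎)
        where
        open ≤-Reasoning

        members-level : ∀ k u → level (members (p , q , k) u) ≤ level k
        members-level k zero                    = p-minimal k
        members-level k (fsuc zero)             = q-minimal k
        members-level k (fsuc (fsuc zero))      = ≤-refl

        below : ∀ k → w l ≤ level k + candidate (p , q , k) l
        below k with minF-attained (λ u → normaliser (members (p , q , k) u) + xs (members (p , q , k) u) l)
        ... | u , candₗ≡ = let s = members (p , q , k) u in begin
          w l                                ≤⟨ minF-≤ _ s ⟩
          λs s + xs s l                      ≡⟨ level-split s l ⟩
          level s + (normaliser s + xs s l)  ≤⟨ +-mono-≤ _ (members-level k u) ⟩
          level k + (normaliser s + xs s l)  ≡⟨ cong (level k +_) (sym candₗ≡) ⟩
          level k + candidate (p , q , k) l  ∎

      decomposition : InHyperplane a w →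
                      ∃ λ p → ∃ λ q → (∀ k → InHyperplane a (candidate (p , q , k))) ×
                                      (∀ l → w l ≡ tropComb level (λ k → candidate (p , q , k)) l)
      decomposition (i , j , i≢j , i-attains , j-attains) with active-minimal i-attains | active-minimal j-attains
      ... | p , p-active , p-minimal | q , q-active , q-minimal =
        p , q , (λ k → candidate-∈H k i≢j p-active q-active) , w-via-candidates p-minimal q-minimal

    module Generators (y₀ : Vec d) (y₀∈P : InPolytope xs y₀) (y₀∈H : InHyperplane a y₀) where

      -- Candidates off the hyperplane are replaced by y₀: this is where P ∩ H ≠ ∅ is used.
      generator : Triple (suc n) → Vec d
      generator τ with InHyperplane? a (candidate τ)
      ... | yes _ = candidate τ
      ... | no _  = y₀

      generator-∈ : ∀ τ → InPolytope xs (generator τ) × InHyperplane a (generator τ)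
      generator-∈ τ with InHyperplane? a (candidate τ)
      ... | yes τ∈H = candidate-∈P τ , τ∈H
      ... | no _    = y₀∈P , y₀∈H

      generator-candidate : ∀ τ → InHyperplane a (candidate τ) → generator τ ≡ candidate τ
      generator-candidate τ τ∈H with InHyperplane? a (candidate τ)
      ... | yes _   = refl
      ... | no τ∉H = contradiction τ∈H τ∉H

      generators : Fin (suc n ℕ.* (suc n ℕ.* suc n)) → Vec d
      generators = generator ∘ toTriple

      candidate-∈generated : ∀ τ → InHyperplane a (candidate τ) → InPolytope generators (candidate τ)
      candidate-∈generated τ τ∈H =
        subst (InPolytope generators) (trans (cong generator (toTriple-fromTriple τ)) (generator-candidate τ τ∈H))
              (InPolytope-generator generators (fromTriple τ))

      P∩H⊆generated : ∀ y → InPolytope xs y × InHyperplane a y → InPolytope generators y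
      P∩H⊆generated y ((λs , y∼w) , y∈H) with Decomposition.decomposition λs (InHyperplane-∼ (∼-sym y∼w) y∈H)
      ... | p , q , candidates∈H , w≗ =
        InPolytope-∼ y∼w (InPolytope-∼ (≗⇒∼ w≗)
          (InPolytope-tropComb generators (Decomposition.level λs) (λ k → candidate (p , q , k)) λ k →
            candidate-∈generated (p , q , k) (candidates∈H k)))

      generated⊆P∩H : ∀ y → InPolytope generators y → InPolytope xs y × InHyperplane a y
      generated⊆P∩H y (μ , y∼z) =
        InPolytope-∼ y∼z (InPolytope-tropComb xs μ generators (proj₁ ∘ generator-∈ ∘ toTriple)) ,
        InHyperplane-∼ y∼z (InHyperplane-tropComb-closed μ generators (proj₂ ∘ generator-∈ ∘ toTriple))

corollary2p15 : (ℝ : RealField) → let open Tropical ℝ in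
    (d n : ℕ) (xs : Fin (suc n) → Vec d) (a : Vec d) →
    (∃ λ y → InPolytope xs y × InHyperplane a y) →
    IsTropicalPolytope (λ y → InPolytope xs y × InHyperplane a y)
corollary2p15 ℝ d n xs a (y₀ , y₀∈P , y₀∈H) =
  _ , generators , λ y → P∩H⊆generated y , generated⊆P∩H y
  where
  open TropicalConvexity ℝ
  open Intersection xs a
  open Generators y₀ y₀∈P y₀∈H
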